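{- For every integer $k\ge 4$, the path $P_k$ defines the graphs $P_3$ and $C_4$; that is, there are coalition partitions $\Psi_1,\Psi_2$ of $P_k$ with $\mathrm{CG}(P_k,\Psi_1)\cong P_3$ and $\mathrm{CG}(P_k,\Psi_2)\cong C_4$.
   Context: For a graph $G$ with vertex set $V$, a set $S\subseteq V$ is a dominating set if every vertex of $V\setminus S$ is adjacent to a vertex of $S$. Two disjoint sets $V_1,V_2\subseteq V$ form a coalition in $G$ if neither is a dominating set of $G$ but $V_1\cup V_2$ is. A coalition partition of $G$ is a partition $\Psi=\{V_1,\ldots,V_k\}$ of $V$ such that every $V_i\in\Psi$ is either a dominating set of $G$ with $|V_i|=1$, or is not a dominating set and forms a coalition with some $V_j\in\Psi$. Given a coalition partition $\Psi$ of $G$, the coalition graph $\mathrm{CG}(G,\Psi)$ has vertex set $\Psi$, two members adjacent iff they form a coalition in $G$. $P_k$ is the path on $k$ vertices; $C_4$ is the $4$-cycle. -}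

module Defs where

open import Data.Nat using (ℕ; zero; suc)
open import Data.Fin using (Fin; toℕ)
open import Data.Product using (Σ; ∃; _×_; _,_)
open import Data.Sum using (_⊎_)
open import Relation.Nullary using (¬_)
open import Data.Empty using (⊥)
open import Relation.Binary.PropositionalEquality using (_≡_; _≢_)
open import Function.Bundles using (_⤖_; Bijection)
open import Function using (_⇔_)

record Graph (n : ℕ) : Set₁ where
  field
    Adj : Fin n → Fin n → Set
open Graph public

PathAdj : {k : ℕ} → Fin k → Fin k → Set
PathAdj i j = (toℕ j ≡ suc (toℕ i)) ⊎ (toℕ i ≡ suc (toℕ j))

P : (k : ℕ) → Graph k
P k = record { Adj = PathAdj }

C4Adj : Fin 4 → Fin 4 → Set
C4Adj i j = PathAdj i j ⊎ ((toℕ i ≡ 0 × toℕ j ≡ 3) ⊎ (toℕ i ≡ 3 × toℕ j ≡ 0))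

C4 : Graph 4
C4 = record { Adj = C4Adj }

Subset : ℕ → Set₁
Subset n = Fin n → Set

_∪_ : {n : ℕ} → Subset n → Subset n → Subset n
(S ∪ T) v = S v ⊎ T v

Dominating : {n : ℕ} → Graph n → Subset n → Set
Dominating G S = ∀ v → ¬ S v → ∃ λ u → S u × Adj G u v

Disjoint : {n : ℕ} → Subset n → Subset n → Set
Disjoint S T = ∀ v → S v → T v → ⊥


FormCoalition : {n : ℕ} → Graph n → Subset n → Subset n → Set
FormCoalition G S T =
  Disjoint S T × ¬ Dominating G S × ¬ Dominating G T × Dominating G (S ∪ T)

-- A partition of Fin n into m (nonempty) blocks, encoded by a surjective
-- labelling f : Fin n → Fin m; block i is { v | f v ≡ i }.
Block : {n m : ℕ} → (Fin n → Fin m) → Fin m → Subset n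
Block f i v = f v ≡ i

IsPartition : {n m : ℕ} → (Fin n → Fin m) → Set
IsPartition {n} {m} f = ∀ (i : Fin m) → ∃ λ v → f v ≡ i

Singleton : {n : ℕ} → Subset n → Set
Singleton S = ∃ λ v → S v × (∀ w → S w → w ≡ v)

IsCoalitionPartition : {n m : ℕ} → Graph n → (Fin n → Fin m) → Set
IsCoalitionPartition {n} {m} G f =
  IsPartition f ×
  (∀ (i : Fin m) →
     (Dominating G (Block f i) × Singleton (Block f i))
     ⊎ (¬ Dominating G (Block f i) ×
        ∃ λ j → j ≢ i × FormCoalition G (Block f i) (Block f j)))

CG : {n m : ℕ} → Graph n → (Fin n → Fin m) → Graph m
CG G f = record { Adj = λ i j → i ≢ j × FormCoalition G (Block f i) (Block f j) }

_≅_ : {m n : ℕ} → Graph m → Graph n → Set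
_≅_ {m} {n} G H =
  Σ (Fin m ⤖ Fin n) λ σ →
    ∀ i j → Adj G i j ⇔ Adj H (Bijection.to σ i) (Bijection.to σ j)

Defines : {n r : ℕ} → Graph n → Graph r → Set
Defines {n} G H =
  ∃ λ (m : ℕ) → Σ (Fin n → Fin m) λ f → IsCoalitionPartition G f × (CG G f ≅ H)

-- Number the vertices of P_k as 0, …, k−1 and split them into the two "ends"
-- {0} and {1} and the two "sides" {2, 4, 6, …} and {3, 5, 7, …}.  A side
-- covers every vertex from 2 on (vertex 2 through vertex 3, the rest through
-- their predecessor), and either end covers both 0 and 1; so an end and a
-- side together dominate P_k.  The two ends miss vertex 3 and the two sides
-- miss vertex 0, hence no block dominates on its own, and the coalition graph
-- is the complete bipartite graph between ends and sides, i.e. C_4.  Merging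
-- the two sides yields a partition whose coalition graph is the path
-- {0} — sides — {1}.

module Submission where

open import Defs
open import Data.Fin using (Fin; zero; suc; toℕ; inject₁)
open import Data.Fin.Properties using (toℕ-inject₁)
open import Data.Nat using (ℕ; suc; _+_; _≤_; _≟_; parity)
open import Data.Nat.Properties using (m≤n⇒∃[o]m+o≡n)
open import Data.Parity.Base using (Parity; 0ℙ; 1ℙ; _⁻¹)
open import Data.Parity.Properties using (suc-homo-⁻¹) renaming (_≟_ to _≟ᵖ_)
open import Data.Product using (_×_; _,_; ∃; proj₁; proj₂; map₁; map₂)
open import Data.Sum using (_⊎_; inj₁; inj₂; [_,_]; swap) renaming (map to ⊎-map)
open import Function using (_∘_; id; _⇔_; Equivalence)
open import Function.Bundles using (mk⇔)
open import Function.Construct.Identity using (⤖-id)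
open import Function.Properties.Equivalence using () renaming (sym to ⇔-sym; trans to ⇔-trans)
open import Relation.Binary.Definitions using (Decidable)
open import Relation.Binary.PropositionalEquality using (_≡_; _≢_; refl; sym; trans; cong; ≢-sym)
open import Relation.Nullary using (¬_; contradiction; yes; no)
open import Relation.Nullary.Decidable using (True; False; toWitness; toWitnessFalse; _⊎-dec_; _×-dec_)
open import Relation.Unary using (_⊆_)

Covered : {n : ℕ} → Graph n → Subset n → Fin n → Set
Covered G S v = S v ⊎ ∃ λ u → S u × Adj G u v

module _ {n : ℕ} {G : Graph n} where

  Covered-mono : {S T : Subset n} → S ⊆ T → Covered G S ⊆ Covered G T
  Covered-mono S⊆T = ⊎-map S⊆T (map₂ (map₁ S⊆T))

  dominating : {S : Subset n} → (∀ v → Covered G S v) → Dominating G S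
  dominating cover v v∉S = [ (λ v∈S → contradiction v∈S v∉S) , id ] (cover v)

  Dominating-mono : {S T : Subset n} → S ⊆ T → Dominating G S → Dominating G T
  Dominating-mono S⊆T S-dominating v v∉T =
    map₂ (map₁ S⊆T) (S-dominating v (v∉T ∘ S⊆T))

  Dominating-∪-comm : {S T : Subset n} → Dominating G (S ∪ T) → Dominating G (T ∪ S)
  Dominating-∪-comm = Dominating-mono swap

  undominated⇒¬Dominating : {S : Subset n} (x : Fin n) → ¬ S x →
                             (∀ u → S u → ¬ Adj G u x) → ¬ Dominating G S
  undominated⇒¬Dominating x x∉S no-neighbour S-dominating =
    let u , u∈S , u~x = S-dominating x x∉S in no-neighbour u u∈S u~x

IsPartition-∘ : {n m r : ℕ} {g : Fin n → Fin m} {h : Fin m → Fin r} →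
                IsPartition g → IsPartition h → IsPartition (h ∘ g)
IsPartition-∘ {h = h} g-onto h-onto i =
  let j , hj≡i = h-onto i
      v , gv≡j = g-onto j
  in v , trans (cong h gv≡j) hj≡i

Dominating-∘ : {n m r : ℕ} {G : Graph n} {g : Fin n → Fin m} (h : Fin m → Fin r) {a b : Fin m} →
               Dominating G (Block g a ∪ Block g b) →
               Dominating G (Block (h ∘ g) (h a) ∪ Block (h ∘ g) (h b))
Dominating-∘ h = Dominating-mono (⊎-map (cong h) (cong h))

Coalesces : {n m : ℕ} → Graph n → (Fin n → Fin m) → Fin m → Fin m → Set
Coalesces G f i j = i ≢ j × Dominating G (Block f i ∪ Block f j)

Coalesces-irrefl : {n m : ℕ} {G : Graph n} {f : Fin n → Fin m} {i : Fin m} → ¬ Coalesces G f i i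
Coalesces-irrefl (i≢i , _) = i≢i refl

module _ {n m : ℕ} {G : Graph n} {f : Fin n → Fin m}
         (blocks-¬dominating : ∀ i → ¬ Dominating G (Block f i)) where

  Coalesces⇒FormCoalition : ∀ {i j} → Coalesces G f i j → FormCoalition G (Block f i) (Block f j)
  Coalesces⇒FormCoalition {i} {j} (i≢j , dominates) =
    (λ v v∈i v∈j → i≢j (trans (sym v∈i) v∈j)) ,
    blocks-¬dominating i , blocks-¬dominating j , dominates

  CG-Adj⇔Coalesces : ∀ i j → Adj (CG G f) i j ⇔ Coalesces G f i j
  CG-Adj⇔Coalesces i j =
    mk⇔ (λ (i≢j , _ , _ , _ , dominates) → i≢j , dominates)
        (λ coalesce → proj₁ coalesce , Coalesces⇒FormCoalition coalesce)

  Coalesces⇒IsCoalitionPartition : IsPartition f → (∀ i → ∃ (Coalesces G f i)) →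
                                   IsCoalitionPartition G f
  Coalesces⇒IsCoalitionPartition f-onto partner = f-onto , λ i →
    let j , coalesce = partner i
    in inj₂ (blocks-¬dominating i , j , ≢-sym (proj₁ coalesce) , Coalesces⇒FormCoalition coalesce)

  Defines-by-Coalesces : {H : Graph m} → IsPartition f →
                         (∀ i j → Adj H i j ⇔ Coalesces G f i j) →
                         (∀ i → ∃ (Adj H i)) → Defines G H
  Defines-by-Coalesces f-onto H⇔Coalesces no-isolated =
    m , f , Coalesces⇒IsCoalitionPartition f-onto partner , ⤖-id _ ,
    λ i j → ⇔-trans (CG-Adj⇔Coalesces i j) (⇔-sym (H⇔Coalesces i j))
    where
    partner : ∀ i → ∃ (Coalesces G f i)
    partner i = let j , i~j = no-isolated i in j , Equivalence.to (H⇔Coalesces i j) i~j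

module _ {n m : ℕ} {G : Graph n} {H : Graph m} {f : Fin n → Fin m}
         (Adj? : Decidable (Adj H)) where

  adjacent-coalesce : ∀ {i j} {adjacent : True (Adj? i j)} → i ≢ j →
                      Dominating G (Block f i ∪ Block f j) → Adj H i j ⇔ Coalesces G f i j
  adjacent-coalesce {adjacent = adjacent} i≢j dominates =
    mk⇔ (λ _ → i≢j , dominates) (λ _ → toWitness adjacent)

  nonadjacent-¬coalesce : ∀ {i j} {nonadjacent : False (Adj? i j)} → ¬ Coalesces G f i j →
                          Adj H i j ⇔ Coalesces G f i j
  nonadjacent-¬coalesce {nonadjacent = nonadjacent} ¬coalesce =
    mk⇔ (λ i~j → contradiction i~j (toWitnessFalse nonadjacent))
        (λ coalesce → contradiction coalesce ¬coalesce)

PathAdj? : {k : ℕ} → Decidable (PathAdj {k})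
PathAdj? i j = toℕ j ≟ suc (toℕ i) ⊎-dec toℕ i ≟ suc (toℕ j)

C4Adj? : Decidable C4Adj
C4Adj? i j = PathAdj? i j ⊎-dec (toℕ i ≟ 0 ×-dec toℕ j ≟ 3) ⊎-dec (toℕ i ≟ 3 ×-dec toℕ j ≟ 0)

-- In cyclic order the vertices of C_4 alternate between ends and sides.
pattern end₀  = zero
pattern side₀ = suc zero
pattern end₁  = suc (suc zero)
pattern side₁ = suc (suc (suc zero))

end side : Parity → Fin 4
end 0ℙ = end₀
end 1ℙ = end₁
side 0ℙ = side₀
side 1ℙ = side₁

-- A vertex is labelled by the parity of its index, since parity (2 + t) = parity t.
Ψ-C4 : {k : ℕ} → Fin k → Fin 4
Ψ-C4 zero = end 0ℙ
Ψ-C4 (suc zero) = end 1ℙ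
Ψ-C4 (suc (suc w)) = side (parity (toℕ w))

merge : Fin 4 → Fin 3
merge end₀ = zero
merge side₀ = suc zero
merge end₁ = suc (suc zero)
merge side₁ = suc zero

Ψ-P3 : {k : ℕ} → Fin k → Fin 3
Ψ-P3 = merge ∘ Ψ-C4

merge-onto : IsPartition merge
merge-onto zero = end₀ , refl
merge-onto (suc zero) = side₀ , refl
merge-onto (suc (suc zero)) = end₁ , refl

merged-end : ∀ {j} → merge j ≡ zero ⊎ merge j ≡ suc (suc zero) → j ≡ end₀ ⊎ j ≡ end₁
merged-end {end₀} _ = inj₁ refl
merged-end {end₁} _ = inj₂ refl
merged-end {side₀} (inj₁ ())
merged-end {side₀} (inj₂ ())
merged-end {side₁} (inj₁ ())
merged-end {side₁} (inj₂ ())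

merged-side : ∀ {j} → merge j ≡ suc zero → j ≡ side₀ ⊎ j ≡ side₁
merged-side {side₀} _ = inj₁ refl
merged-side {side₁} _ = inj₂ refl

≢⇒⁻¹≡ : {p q : Parity} → p ≢ q → p ⁻¹ ≡ q
≢⇒⁻¹≡ {0ℙ} {0ℙ} p≢q = contradiction refl p≢q
≢⇒⁻¹≡ {0ℙ} {1ℙ} _ = refl
≢⇒⁻¹≡ {1ℙ} {0ℙ} _ = refl
≢⇒⁻¹≡ {1ℙ} {1ℙ} p≢q = contradiction refl p≢q

module _ {n : ℕ} where

  Ψ-C4-partition : IsPartition (Ψ-C4 {4 + n})
  Ψ-C4-partition end₀ = zero , refl
  Ψ-C4-partition side₀ = suc (suc zero) , refl
  Ψ-C4-partition end₁ = suc zero , refl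
  Ψ-C4-partition side₁ = suc (suc (suc zero)) , refl

  side-neighbour : ∀ p (w : Fin (2 + n)) → parity (toℕ w) ≢ p →
                   ∃ λ u → Block Ψ-C4 (side p) u × PathAdj u (suc (suc w))
  side-neighbour p zero 0≢p = suc (suc (suc zero)) , cong side (≢⇒⁻¹≡ 0≢p) , inj₂ refl
  side-neighbour p (suc w) w+1≢p =
    suc (suc (inject₁ w)) ,
    cong side (trans (cong parity (toℕ-inject₁ w))
                     (trans (sym (suc-homo-⁻¹ (toℕ w))) (≢⇒⁻¹≡ w+1≢p))) ,
    inj₁ (cong (3 +_) (sym (toℕ-inject₁ w)))

  side-covers : ∀ p (w : Fin (2 + n)) → Covered (P (4 + n)) (Block Ψ-C4 (side p)) (suc (suc w))
  side-covers p w with parity (toℕ w) ≟ᵖ p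
  ... | yes w∈p = inj₁ (cong side w∈p)
  ... | no w∉p = inj₂ (side-neighbour p w w∉p)

  end∪side-dominating : ∀ e p → Dominating (P (4 + n)) (Block Ψ-C4 (end e) ∪ Block Ψ-C4 (side p))
  end∪side-dominating e p = dominating (cover e)
    where
    cover : ∀ e v → Covered (P (4 + n)) (Block Ψ-C4 (end e) ∪ Block Ψ-C4 (side p)) v
    cover 0ℙ zero = inj₁ (inj₁ refl)
    cover 1ℙ zero = inj₂ (suc zero , inj₁ refl , inj₂ refl)
    cover 0ℙ (suc zero) = inj₂ (zero , inj₁ refl , inj₁ refl)
    cover 1ℙ (suc zero) = inj₁ (inj₁ refl)
    cover e (suc (suc w)) = Covered-mono {G = P (4 + n)} inj₂ (side-covers p w)

  ends-¬dominating : ¬ Dominating (P (4 + n)) (Block Ψ-C4 end₀ ∪ Block Ψ-C4 end₁)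
  ends-¬dominating = undominated⇒¬Dominating (suc (suc (suc zero))) [ (λ ()) , (λ ()) ] no-neighbour
    where
    no-neighbour : ∀ u → (Block Ψ-C4 end₀ ∪ Block Ψ-C4 end₁) u → ¬ PathAdj u (suc (suc (suc zero)))
    no-neighbour zero _ (inj₁ ())
    no-neighbour zero _ (inj₂ ())
    no-neighbour (suc zero) _ (inj₁ ())
    no-neighbour (suc zero) _ (inj₂ ())
    no-neighbour (suc (suc zero)) (inj₁ ()) _
    no-neighbour (suc (suc zero)) (inj₂ ()) _
    no-neighbour (suc (suc (suc zero))) _ (inj₁ ())
    no-neighbour (suc (suc (suc zero))) _ (inj₂ ())
    no-neighbour (suc (suc (suc (suc zero)))) (inj₁ ()) _
    no-neighbour (suc (suc (suc (suc zero)))) (inj₂ ()) _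
    no-neighbour (suc (suc (suc (suc (suc _))))) _ (inj₁ ())
    no-neighbour (suc (suc (suc (suc (suc _))))) _ (inj₂ ())

  sides-¬dominating : ¬ Dominating (P (4 + n)) (Block Ψ-C4 side₀ ∪ Block Ψ-C4 side₁)
  sides-¬dominating = undominated⇒¬Dominating zero [ (λ ()) , (λ ()) ] no-neighbour
    where
    no-neighbour : ∀ u → (Block Ψ-C4 side₀ ∪ Block Ψ-C4 side₁) u → ¬ PathAdj u zero
    no-neighbour zero _ (inj₁ ())
    no-neighbour zero _ (inj₂ ())
    no-neighbour (suc zero) (inj₁ ()) _
    no-neighbour (suc zero) (inj₂ ()) _
    no-neighbour (suc (suc _)) _ (inj₁ ())
    no-neighbour (suc (suc _)) _ (inj₂ ())

  Ψ-C4-blocks-¬dominating : ∀ i → ¬ Dominating (P (4 + n)) (Block Ψ-C4 i)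
  Ψ-C4-blocks-¬dominating end₀ = ends-¬dominating ∘ Dominating-mono inj₁
  Ψ-C4-blocks-¬dominating side₀ = sides-¬dominating ∘ Dominating-mono inj₁
  Ψ-C4-blocks-¬dominating end₁ = ends-¬dominating ∘ Dominating-mono inj₂
  Ψ-C4-blocks-¬dominating side₁ = sides-¬dominating ∘ Dominating-mono inj₂

  C4⇔Coalesces : ∀ i j → C4Adj i j ⇔ Coalesces (P (4 + n)) Ψ-C4 i j
  C4⇔Coalesces end₀ end₀ = nonadjacent-¬coalesce C4Adj? Coalesces-irrefl
  C4⇔Coalesces end₀ side₀ = adjacent-coalesce C4Adj? (λ ()) (end∪side-dominating 0ℙ 0ℙ)
  C4⇔Coalesces end₀ end₁ = nonadjacent-¬coalesce C4Adj? (ends-¬dominating ∘ proj₂)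
  C4⇔Coalesces end₀ side₁ = adjacent-coalesce C4Adj? (λ ()) (end∪side-dominating 0ℙ 1ℙ)
  C4⇔Coalesces side₀ end₀ = adjacent-coalesce C4Adj? (λ ()) (Dominating-∪-comm (end∪side-dominating 0ℙ 0ℙ))
  C4⇔Coalesces side₀ side₀ = nonadjacent-¬coalesce C4Adj? Coalesces-irrefl
  C4⇔Coalesces side₀ end₁ = adjacent-coalesce C4Adj? (λ ()) (Dominating-∪-comm (end∪side-dominating 1ℙ 0ℙ))
  C4⇔Coalesces side₀ side₁ = nonadjacent-¬coalesce C4Adj? (sides-¬dominating ∘ proj₂)
  C4⇔Coalesces end₁ end₀ = nonadjacent-¬coalesce C4Adj? (ends-¬dominating ∘ Dominating-∪-comm ∘ proj₂)
  C4⇔Coalesces end₁ side₀ = adjacent-coalesce C4Adj? (λ ()) (end∪side-dominating 1ℙ 0ℙ)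
  C4⇔Coalesces end₁ end₁ = nonadjacent-¬coalesce C4Adj? Coalesces-irrefl
  C4⇔Coalesces end₁ side₁ = adjacent-coalesce C4Adj? (λ ()) (end∪side-dominating 1ℙ 1ℙ)
  C4⇔Coalesces side₁ end₀ = adjacent-coalesce C4Adj? (λ ()) (Dominating-∪-comm (end∪side-dominating 0ℙ 1ℙ))
  C4⇔Coalesces side₁ side₀ = nonadjacent-¬coalesce C4Adj? (sides-¬dominating ∘ Dominating-∪-comm ∘ proj₂)
  C4⇔Coalesces side₁ end₁ = adjacent-coalesce C4Adj? (λ ()) (Dominating-∪-comm (end∪side-dominating 1ℙ 1ℙ))
  C4⇔Coalesces side₁ side₁ = nonadjacent-¬coalesce C4Adj? Coalesces-irrefl

  C4-no-isolated : ∀ i → ∃ (C4Adj i)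
  C4-no-isolated end₀ = side₀ , inj₁ (inj₁ refl)
  C4-no-isolated side₀ = end₀ , inj₁ (inj₂ refl)
  C4-no-isolated end₁ = side₀ , inj₁ (inj₂ refl)
  C4-no-isolated side₁ = end₀ , inj₂ (inj₂ (refl , refl))

  P-defines-C4 : Defines (P (4 + n)) C4
  P-defines-C4 = Defines-by-Coalesces Ψ-C4-blocks-¬dominating Ψ-C4-partition C4⇔Coalesces C4-no-isolated

  Ψ-P3-partition : IsPartition (Ψ-P3 {4 + n})
  Ψ-P3-partition = IsPartition-∘ Ψ-C4-partition merge-onto

  Ψ-P3-blocks-¬dominating : ∀ i → ¬ Dominating (P (4 + n)) (Block Ψ-P3 i)
  Ψ-P3-blocks-¬dominating zero = ends-¬dominating ∘ Dominating-mono (merged-end ∘ inj₁)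
  Ψ-P3-blocks-¬dominating (suc zero) = sides-¬dominating ∘ Dominating-mono merged-side
  Ψ-P3-blocks-¬dominating (suc (suc zero)) = ends-¬dominating ∘ Dominating-mono (merged-end ∘ inj₂)

  P3⇔Coalesces : ∀ i j → PathAdj i j ⇔ Coalesces (P (4 + n)) Ψ-P3 i j
  P3⇔Coalesces zero zero = nonadjacent-¬coalesce PathAdj? Coalesces-irrefl
  P3⇔Coalesces zero (suc zero) =
    adjacent-coalesce PathAdj? (λ ()) (Dominating-∘ merge (end∪side-dominating 0ℙ 0ℙ))
  P3⇔Coalesces zero (suc (suc zero)) =
    nonadjacent-¬coalesce PathAdj? (ends-¬dominating ∘ Dominating-mono merged-end ∘ proj₂)
  P3⇔Coalesces (suc zero) zero =
    adjacent-coalesce PathAdj? (λ ()) (Dominating-∘ merge (Dominating-∪-comm (end∪side-dominating 0ℙ 0ℙ)))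
  P3⇔Coalesces (suc zero) (suc zero) = nonadjacent-¬coalesce PathAdj? Coalesces-irrefl
  P3⇔Coalesces (suc zero) (suc (suc zero)) =
    adjacent-coalesce PathAdj? (λ ()) (Dominating-∘ merge (Dominating-∪-comm (end∪side-dominating 1ℙ 0ℙ)))
  P3⇔Coalesces (suc (suc zero)) zero =
    nonadjacent-¬coalesce PathAdj? (ends-¬dominating ∘ Dominating-mono (merged-end ∘ swap) ∘ proj₂)
  P3⇔Coalesces (suc (suc zero)) (suc zero) =
    adjacent-coalesce PathAdj? (λ ()) (Dominating-∘ merge (end∪side-dominating 1ℙ 0ℙ))
  P3⇔Coalesces (suc (suc zero)) (suc (suc zero)) = nonadjacent-¬coalesce PathAdj? Coalesces-irrefl

  P3-no-isolated : ∀ i → ∃ (PathAdj {3} i)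
  P3-no-isolated zero = suc zero , inj₁ refl
  P3-no-isolated (suc zero) = zero , inj₂ refl
  P3-no-isolated (suc (suc zero)) = suc zero , inj₂ refl

  P-defines-P3 : Defines (P (4 + n)) (P 3)
  P-defines-P3 = Defines-by-Coalesces Ψ-P3-blocks-¬dominating Ψ-P3-partition P3⇔Coalesces P3-no-isolated

proposition5 : (k : ℕ) → 4 ≤ k → Defines (P k) (P 3) × Defines (P k) C4
proposition5 k 4≤k with m≤n⇒∃[o]m+o≡n 4≤k
... | n , refl = P-defines-P3 , P-defines-C4
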